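{- Let $k\geq 2$ be an integer. For a word $w=w_1\cdots w_n\in[k]^n$ (where $[k]=\{1,\ldots,k\}$) let $s(w)=\#\{1\leq i\leq n-1 : |w_{i+1}-w_i|\leq 1\}$, and let \[F(x,t)=\sum_{n\geq 0}\sum_{w\in[k]^n} t^{s(w)}x^n\] (the empty word contributing $1$). Let $\phi = \frac{1-x(t-1)}{2x(t-1)}$ and \[\gamma(x,t) = \frac{k}{1-3x(t-1)}-\frac{2x(t-1)}{(1-3x(t-1))^{2}}\cdot\frac{U_{k}(\phi)-U_{k-1}(\phi)-1}{U_{k}(\phi)}.\] Then \[F(x,t) = \frac{1}{1-x\gamma(x,t)}.\]
   Context: $U_n(y)$ denotes the Chebyshev polynomial of the second kind, defined by $U_0(y)=1$, $U_1(y)=2y$, $U_{n+1}(y)=2yU_n(y)-U_{n-1}(y)$. A word over $k$ of length $n$ is an element of $[k]^n$. The identity is an identity of generating functions (rational functions in $x,t$). -}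

module Defs where

open import Data.Nat as ℕ using (ℕ; zero; suc; ∣_-_∣; _≤ᵇ_; _≡ᵇ_)
open import Data.Integer using (ℤ; +_; _+_; _*_; _-_)
open import Data.Fin using (Fin; toℕ)
open import Data.Vec using (Vec; []; _∷_)
open import Data.List using (List; []; _∷_; map; concatMap; allFin)
open import Relation.Binary.PropositionalEquality using (_≡_)
open import Data.Bool using (if_then_else_)

-- ===== Words over [k] = Fin k (letter i ∈ Fin k stands for i+1 ∈ [k]) =====

words : (k n : ℕ) → List (Vec (Fin k) n)
words k zero    = [] ∷ []
words k (suc n) = concatMap (λ a → map (a ∷_) (words k n)) (allFin k)

s : ∀ {k n} → Vec (Fin k) n → ℕ
s []                = 0
s (a ∷ [])          = 0
s (a ∷ w@(b ∷ _))   = (if ∣ toℕ b - toℕ a ∣ ≤ᵇ 1 then 1 else 0) ℕ.+ s w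

-- ===== Formal power series in two variables x, t with integer coefficients =====
-- f i j = coefficient of x^i t^j
Ser : Set
Ser = ℕ → ℕ → ℤ

sumTo : ℕ → (ℕ → ℤ) → ℤ
sumTo zero    h = h 0
sumTo (suc n) h = sumTo n h + h (suc n)

_≈ₛ_ : Ser → Ser → Set
f ≈ₛ g = ∀ i j → f i j ≡ g i j

infix 4 _≈ₛ_
infixl 6 _⊕_ _⊖_
infixl 7 _⊗_

_⊕_ : Ser → Ser → Ser
(f ⊕ g) i j = f i j + g i j

_⊖_ : Ser → Ser → Ser
(f ⊖ g) i j = f i j - g i j

_⊗_ : Ser → Ser → Ser
(f ⊗ g) i j = sumTo i (λ a → sumTo j (λ b → f a b * g (i ℕ.∸ a) (j ℕ.∸ b)))

cst : ℤ → Ser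
cst c zero zero = c
cst c _    _    = + 0

X : Ser
X (suc zero) zero = + 1
X _ _ = + 0

T : Ser
T zero (suc zero) = + 1
T _ _ = + 0

_^ₛ_ : Ser → ℕ → Ser
f ^ₛ zero  = cst (+ 1)
f ^ₛ suc n = f ⊗ (f ^ₛ n)

countS : ∀ {k n} → ℕ → List (Vec (Fin k) n) → ℕ
countS j []       = 0
countS j (w ∷ ws) = (if s w ≡ᵇ j then 1 else 0) ℕ.+ countS j ws

F : ℕ → Ser
F k n j = + countS j (words k n)

-- ===== Chebyshev data, homogenised =====
-- u = x(t-1);  φ = a / b  with  a = 1 - u,  b = 2u.
u : Ser
u = X ⊗ (T ⊖ cst (+ 1))

aφ : Ser
aφ = cst (+ 1) ⊖ u

bφ : Ser
bφ = cst (+ 2) ⊗ u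

-- Uh n = b^n · U_n(a/b), a polynomial: Uh 0 = 1, Uh 1 = 2a,
-- Uh (n+2) = 2a·Uh(n+1) − b²·Uh n   (the Chebyshev recurrence multiplied by b^(n+2)).
Uh : ℕ → Ser
Uh zero          = cst (+ 1)
Uh (suc zero)    = cst (+ 2) ⊗ aφ
Uh (suc (suc n)) = cst (+ 2) ⊗ aφ ⊗ Uh (suc n) ⊖ (bφ ^ₛ 2) ⊗ Uh n

v : Ser
v = cst (+ 1) ⊖ cst (+ 3) ⊗ u

-- Common denominator D = (1-3u)^2 · b^k U_k(φ), and
-- D · x γ(x,t) = x·[ k(1-3u)·b^k U_k(φ) − 2u·( b^k U_k(φ) − b·b^(k-1) U_{k-1}(φ) − b^k ) ].
Dk : ℕ → Ser
Dk k = (v ^ₛ 2) ⊗ Uh k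

xγNum : ℕ → Ser
xγNum k = X ⊗ ( cst (+ k) ⊗ v ⊗ Uh k
               ⊖ cst (+ 2) ⊗ u ⊗ (Uh k ⊖ bφ ⊗ Uh (k ℕ.∸ 1) ⊖ (bφ ^ₛ k)) )

-- Transfer-matrix method. Grouping the nonempty words by their first letter a gives series G_a with
-- F = 1 + Σ_a G_a and G_a = x F + u Σ_{|a-b| ≤ 1} G_b, where u = x(t - 1): a linear system whose matrix
-- is the adjacency matrix (with loops) of the path 0 — 1 — ⋯ — (k-1). Writing U_n for U_n(φ), the row
-- vector y_a = (1 - 3u)(U_k - U_a - U_(k-1-a)) satisfies y_b - u Σ_{|a-b| ≤ 1} y_a = (1 - 3u)² U_k by
-- the Chebyshev recurrence; the boundary rows work because the same formula gives y_(-1) = y_k = 0.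
-- Pairing the system with y yields (1 - 3u)² U_k (F - 1) = (Σ_a y_a) x F, and Σ_a y_a is computed from
-- the classical partial sums of Chebyshev polynomials. All of this is homogenised by powers of 2u, as in
-- Defs, and takes place in ℤ[[x, t]], realised as the iterated Cauchy-product ring ℤ[[t]][[x]] so that
-- the ring solver applies.

module Submission where

open import Defs
open import Data.Nat using (ℕ; _≤_)
open import Algebra.Bundles using (CommutativeRing; RawRing)
open import Level using (0ℓ)

module FormalPowerSeries {c ℓ} (R : CommutativeRing c ℓ) where

  open import Data.Nat as ℕ using (ℕ; zero; suc; _∸_; _≤_; z≤n)
  import Data.Nat.Properties as ℕₚ
  open import Relation.Binary.PropositionalEquality as ≡ using (_≡_)
  open import Algebra.Structures using (IsCommutativeRing)
  import Algebra.Construct.Pointwise as Pointwise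
  open import Data.Product using (_,_)

  open CommutativeRing R hiding (isCommutativeRing)
  open import Relation.Binary.Reasoning.Setoid setoid

  Series : Set c
  Series = ℕ → Carrier

  Σ≤ : ℕ → (ℕ → Carrier) → Carrier
  Σ≤ zero    h = h 0
  Σ≤ (suc n) h = Σ≤ n h + h (suc n)

  Σ≤-cong-≤ : ∀ n {h h′ : ℕ → Carrier} → (∀ a → a ≤ n → h a ≈ h′ a) → Σ≤ n h ≈ Σ≤ n h′
  Σ≤-cong-≤ zero    h≈h′ = h≈h′ 0 z≤n
  Σ≤-cong-≤ (suc n) h≈h′ = +-cong (Σ≤-cong-≤ n λ a a≤n → h≈h′ a (ℕₚ.m≤n⇒m≤1+n a≤n)) (h≈h′ (suc n) ℕₚ.≤-refl)

  Σ≤-cong : ∀ n {h h′ : ℕ → Carrier} → (∀ a → h a ≈ h′ a) → Σ≤ n h ≈ Σ≤ n h′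
  Σ≤-cong n h≈h′ = Σ≤-cong-≤ n λ a _ → h≈h′ a

  Σ≤-cong-bound : ∀ {m n} (h : ℕ → Carrier) → m ≡ n → Σ≤ m h ≈ Σ≤ n h
  Σ≤-cong-bound h ≡.refl = refl

  Σ≤-head : ∀ n (h : ℕ → Carrier) → Σ≤ (suc n) h ≈ h 0 + Σ≤ n (λ a → h (suc a))
  Σ≤-head zero    h = refl
  Σ≤-head (suc n) h = trans (+-congʳ (Σ≤-head n h)) (+-assoc _ _ _)

  Σ≤-zero : ∀ n (h : ℕ → Carrier) → (∀ a → h a ≈ 0#) → Σ≤ n h ≈ 0#
  Σ≤-zero zero    h h≈0 = h≈0 0
  Σ≤-zero (suc n) h h≈0 = trans (+-cong (Σ≤-zero n h h≈0) (h≈0 (suc n))) (+-identityˡ 0#)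

  Σ≤-distrib-+ : ∀ n (h h′ : ℕ → Carrier) → Σ≤ n (λ a → h a + h′ a) ≈ Σ≤ n h + Σ≤ n h′
  Σ≤-distrib-+ zero    h h′ = refl
  Σ≤-distrib-+ (suc n) h h′ = begin
    Σ≤ n (λ a → h a + h′ a) + (h (suc n) + h′ (suc n)) ≈⟨ +-congʳ (Σ≤-distrib-+ n h h′) ⟩
    (Σ≤ n h + Σ≤ n h′) + (h (suc n) + h′ (suc n))     ≈⟨ interchange _ _ _ _ ⟩
    (Σ≤ n h + h (suc n)) + (Σ≤ n h′ + h′ (suc n))     ∎
    where open import Algebra.Properties.CommutativeSemigroup +-commutativeSemigroup using (interchange)

  *-distribˡ-Σ≤ : ∀ n x (h : ℕ → Carrier) → x * Σ≤ n h ≈ Σ≤ n (λ a → x * h a)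
  *-distribˡ-Σ≤ zero    x h = refl
  *-distribˡ-Σ≤ (suc n) x h = trans (distribˡ x _ _) (+-congʳ (*-distribˡ-Σ≤ n x h))

  *-distribʳ-Σ≤ : ∀ n x (h : ℕ → Carrier) → Σ≤ n h * x ≈ Σ≤ n (λ a → h a * x)
  *-distribʳ-Σ≤ n x h =
    trans (*-comm _ x) (trans (*-distribˡ-Σ≤ n x h) (Σ≤-cong n λ a → *-comm x (h a)))

  Σ≤-reverse : ∀ n (h : ℕ → Carrier) → Σ≤ n h ≈ Σ≤ n (λ a → h (n ∸ a))
  Σ≤-reverse zero    h = refl
  Σ≤-reverse (suc n) h = begin
    Σ≤ n h + h (suc n)                    ≈⟨ +-comm _ _ ⟩
    h (suc n) + Σ≤ n h                    ≈⟨ +-congˡ (Σ≤-reverse n h) ⟩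
    h (suc n) + Σ≤ n (λ a → h (n ∸ a))    ≈⟨ Σ≤-head n (λ a → h (suc n ∸ a)) ⟨
    Σ≤ (suc n) (λ a → h (suc n ∸ a))      ∎

  Σ≤-triangle : ∀ n (K : ℕ → ℕ → Carrier) →
                Σ≤ n (λ c → Σ≤ c (λ a → K a c)) ≈ Σ≤ n (λ a → Σ≤ (n ∸ a) (λ b → K a (a ℕ.+ b)))
  Σ≤-triangle zero    K = refl
  Σ≤-triangle (suc n) K = begin
    Σ≤ n (λ c → Σ≤ c (λ a → K a c)) + (Σ≤ n (λ a → K a (suc n)) + K (suc n) (suc n))
      ≈⟨ +-congʳ (Σ≤-triangle n K) ⟩
    Σ≤ n row + (Σ≤ n (λ a → K a (suc n)) + K (suc n) (suc n))
      ≈⟨ +-assoc _ _ _ ⟨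
    (Σ≤ n row + Σ≤ n (λ a → K a (suc n))) + K (suc n) (suc n)
      ≈⟨ +-cong (Σ≤-distrib-+ n _ _) (reflexive (≡.cong (K (suc n)) (ℕₚ.+-identityʳ (suc n)))) ⟨
    Σ≤ n (λ a → row a + K a (suc n)) + K (suc n) (suc n ℕ.+ 0)
      ≈⟨ +-cong (Σ≤-cong-≤ n extend-row) (Σ≤-cong-bound (λ b → K (suc n) (suc n ℕ.+ b)) (≡.sym (ℕₚ.n∸n≡0 n))) ⟩
    Σ≤ n (λ a → Σ≤ (suc n ∸ a) (λ b → K a (a ℕ.+ b))) + Σ≤ (suc n ∸ suc n) (λ b → K (suc n) (suc n ℕ.+ b))
      ∎
    where
    row : ℕ → Carrier
    row a = Σ≤ (n ∸ a) (λ b → K a (a ℕ.+ b))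
    extend-row : ∀ a → a ≤ n → row a + K a (suc n) ≈ Σ≤ (suc n ∸ a) (λ b → K a (a ℕ.+ b))
    extend-row a a≤n = begin
      row a + K a (suc n)                       ≈⟨ +-congˡ (reflexive (≡.cong (K a) a+suc[n∸a]≡suc-n)) ⟨
      Σ≤ (suc (n ∸ a)) (λ b → K a (a ℕ.+ b))    ≈⟨ Σ≤-cong-bound _ (≡.sym (ℕₚ.+-∸-assoc 1 a≤n)) ⟩
      Σ≤ (suc n ∸ a) (λ b → K a (a ℕ.+ b))      ∎
      where
      a+suc[n∸a]≡suc-n : a ℕ.+ suc (n ∸ a) ≡ suc n
      a+suc[n∸a]≡suc-n = ≡.trans (ℕₚ.+-suc a (n ∸ a)) (≡.cong suc (ℕₚ.m+[n∸m]≡n a≤n))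

  infixl 7 _✶_
  infix 4 _≋_

  _✶_ : Series → Series → Series
  (f ✶ g) n = Σ≤ n (λ a → f a * g (n ∸ a))

  𝟏 : Series
  𝟏 zero    = 1#
  𝟏 (suc _) = 0#

  _≋_ : Series → Series → Set ℓ
  f ≋ g = ∀ n → f n ≈ g n

  ✶-cong : ∀ {f f′ g g′} → f ≋ f′ → g ≋ g′ → f ✶ g ≋ f′ ✶ g′
  ✶-cong f≋f′ g≋g′ n = Σ≤-cong n λ a → *-cong (f≋f′ a) (g≋g′ (n ∸ a))

  ✶-comm : ∀ f g → f ✶ g ≋ g ✶ f
  ✶-comm f g n = trans (Σ≤-reverse n _) (Σ≤-cong-≤ n λ a a≤n →
    trans (*-comm _ _) (*-congʳ (reflexive (≡.cong g (ℕₚ.m∸[m∸n]≡n a≤n)))))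

  ✶-identityˡ : ∀ f → 𝟏 ✶ f ≋ f
  ✶-identityˡ f zero    = *-identityˡ (f 0)
  ✶-identityˡ f (suc n) = begin
    Σ≤ (suc n) (λ a → 𝟏 a * f (suc n ∸ a))         ≈⟨ Σ≤-head n _ ⟩
    1# * f (suc n) + Σ≤ n (λ a → 0# * f (n ∸ a))   ≈⟨ +-cong (*-identityˡ _) (Σ≤-zero n _ λ a → zeroˡ _) ⟩
    f (suc n) + 0#                                 ≈⟨ +-identityʳ _ ⟩
    f (suc n)                                      ∎

  ✶-distribˡ-+ : ∀ f g h → f ✶ (λ n → g n + h n) ≋ (λ n → (f ✶ g) n + (f ✶ h) n)
  ✶-distribˡ-+ f g h n = trans (Σ≤-cong n λ a → distribˡ (f a) _ _) (Σ≤-distrib-+ n _ _)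

  ✶-assoc : ∀ f g h → (f ✶ g) ✶ h ≋ f ✶ (g ✶ h)
  ✶-assoc f g h n = begin
    Σ≤ n (λ c → Σ≤ c (λ a → f a * g (c ∸ a)) * h (n ∸ c))
      ≈⟨ Σ≤-cong n (λ c → *-distribʳ-Σ≤ c _ _) ⟩
    Σ≤ n (λ c → Σ≤ c (λ a → f a * g (c ∸ a) * h (n ∸ c)))
      ≈⟨ Σ≤-triangle n (λ a c → f a * g (c ∸ a) * h (n ∸ c)) ⟩
    Σ≤ n (λ a → Σ≤ (n ∸ a) (λ b → f a * g (a ℕ.+ b ∸ a) * h (n ∸ (a ℕ.+ b))))
      ≈⟨ Σ≤-cong n (λ a → Σ≤-cong (n ∸ a) λ b → trans
           (*-cong (*-congˡ (reflexive (≡.cong g (ℕₚ.m+n∸m≡n a b))))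
                   (reflexive (≡.cong h (≡.sym (ℕₚ.∸-+-assoc n a b)))))
           (*-assoc _ _ _)) ⟩
    Σ≤ n (λ a → Σ≤ (n ∸ a) (λ b → f a * (g b * h (n ∸ a ∸ b))))
      ≈⟨ Σ≤-cong n (λ a → *-distribˡ-Σ≤ (n ∸ a) (f a) _) ⟨
    Σ≤ n (λ a → f a * Σ≤ (n ∸ a) (λ b → g b * h (n ∸ a ∸ b)))
      ∎

  isCommutativeRing : IsCommutativeRing _≋_ (λ f g n → f n + g n) _✶_ (λ f n → - f n) (λ _ → 0#) 𝟏
  isCommutativeRing = record
    { isRing = record
      { +-isAbelianGroup = Pointwise.isAbelianGroup ℕ +-isAbelianGroup
      ; *-cong           = ✶-cong
      ; *-assoc          = ✶-assoc
      ; *-identity       = ✶-identityˡ , λ f n → trans (✶-comm f 𝟏 n) (✶-identityˡ f n)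
      ; distrib          = ✶-distribˡ-+ , λ h f g n →
          trans (✶-comm _ h n) (trans (✶-distribˡ-+ h f g n) (+-cong (✶-comm h f n) (✶-comm h g n)))
      }
    ; *-comm = ✶-comm
    }

  commutativeRing : CommutativeRing c ℓ
  commutativeRing = record { isCommutativeRing = isCommutativeRing }

module TransferMatrix {c ℓ} (R : CommutativeRing c ℓ) where

  open import Data.Fin using (Fin)
  open CommutativeRing R
  open import Algebra.Properties.Semiring.Sum semiring
  open import Algebra.Properties.Group +-group using (∙-cancelʳ; //-rightDividesʳ)
  open import Algebra.Properties.Ring ring using (x[y-z]≈xy-xz)
  open import Algebra.Properties.CommutativeSemigroup *-commutativeSemigroup using (x∙yz≈y∙xz)
  open import Relation.Binary.Reasoning.Setoid setoid

  -- Pairing G with y gives D Σ G = (Σ y) x F, which turns F = 1 + Σ G into an equation for F alone.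
  transfer-matrix-solution :
    ∀ {k} (M : Fin k → Fin k → Carrier) (G y : Fin k → Carrier) (F x u D : Carrier) →
    F ≈ 1# + ∑[ a < k ] G a →
    (∀ a → G a ≈ x * F + u * ∑[ b < k ] (M a b * G b)) →
    (∀ b → y b ≈ D + u * ∑[ a < k ] (y a * M a b)) →
    F * (D - x * ∑[ a < k ] y a) ≈ D
  transfer-matrix-solution {k} M G y F x u D F≈1+∑G G≈ y≈ = begin
    F * (D - x * ∑y)               ≈⟨ x[y-z]≈xy-xz F D (x * ∑y) ⟩
    F * D - F * (x * ∑y)           ≈⟨ +-congʳ FD≈D+F[x∑y] ⟩
    D + F * (x * ∑y) - F * (x * ∑y) ≈⟨ //-rightDividesʳ (F * (x * ∑y)) D ⟩
    D                              ∎
    where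
    ∑G ∑y : Carrier
    ∑G = ∑[ a < k ] G a
    ∑y = ∑[ a < k ] y a

    N : Fin k → Carrier
    N b = ∑[ a < k ] (y a * M a b)

    common : Carrier
    common = ∑[ b < k ] (u * N b * G b)

    pair-via-G : ∑[ a < k ] (y a * G a) ≈ ∑y * (x * F) + common
    pair-via-G = begin
      ∑[ a < k ] (y a * G a)
        ≈⟨ sum-cong-≋ {k} (λ a → trans (*-congˡ (G≈ a)) (distribˡ (y a) _ _)) ⟩
      ∑[ a < k ] (y a * (x * F) + y a * (u * ∑[ b < k ] (M a b * G b)))
        ≈⟨ ∑-distrib-+ {k} _ _ ⟩
      ∑[ a < k ] (y a * (x * F)) + ∑[ a < k ] (y a * (u * ∑[ b < k ] (M a b * G b)))
        ≈⟨ +-cong (sym (*-distribʳ-sum {k} (x * F) y)) (sum-cong-≋ {k} λ a → x∙yz≈y∙xz (y a) u _) ⟩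
      ∑y * (x * F) + ∑[ a < k ] (u * (y a * ∑[ b < k ] (M a b * G b)))
        ≈⟨ +-congˡ (sym (*-distribˡ-sum {k} u _)) ⟩
      ∑y * (x * F) + u * ∑[ a < k ] (y a * ∑[ b < k ] (M a b * G b))
        ≈⟨ +-congˡ (*-congˡ (sum-cong-≋ {k} λ a → *-distribˡ-sum {k} (y a) _)) ⟩
      ∑y * (x * F) + u * ∑[ a < k ] ∑[ b < k ] (y a * (M a b * G b))
        ≈⟨ +-congˡ (*-congˡ (∑-comm {k} {k} _)) ⟩
      ∑y * (x * F) + u * ∑[ b < k ] ∑[ a < k ] (y a * (M a b * G b))
        ≈⟨ +-congˡ (*-congˡ (sum-cong-≋ {k} λ b → trans (sum-cong-≋ {k} λ a → sym (*-assoc _ _ _))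
                                                   (sym (*-distribʳ-sum {k} (G b) _)))) ⟩
      ∑y * (x * F) + u * ∑[ b < k ] (N b * G b)
        ≈⟨ +-congˡ (trans (*-distribˡ-sum {k} u _) (sum-cong-≋ {k} λ b → sym (*-assoc u (N b) (G b)))) ⟩
      ∑y * (x * F) + common
        ∎

    pair-via-y : ∑[ a < k ] (y a * G a) ≈ D * ∑G + common
    pair-via-y = begin
      ∑[ b < k ] (y b * G b)                  ≈⟨ sum-cong-≋ {k} (λ b → trans (*-congʳ (y≈ b)) (distribʳ (G b) D _)) ⟩
      ∑[ b < k ] (D * G b + u * N b * G b)    ≈⟨ ∑-distrib-+ {k} _ _ ⟩
      ∑[ b < k ] (D * G b) + common              ≈⟨ +-congʳ (sym (*-distribˡ-sum {k} D G)) ⟩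
      D * ∑G + common                            ∎

    D∑G≈∑y[xF] : D * ∑G ≈ ∑y * (x * F)
    D∑G≈∑y[xF] = ∙-cancelʳ common _ _ (trans (sym pair-via-y) pair-via-G)

    FD≈D+F[x∑y] : F * D ≈ D + F * (x * ∑y)
    FD≈D+F[x∑y] = begin
      F * D                         ≈⟨ *-congʳ F≈1+∑G ⟩
      (1# + ∑G) * D                 ≈⟨ distribʳ D 1# ∑G ⟩
      1# * D + ∑G * D               ≈⟨ +-cong (*-identityˡ D) (*-comm ∑G D) ⟩
      D + D * ∑G                    ≈⟨ +-congˡ D∑G≈∑y[xF] ⟩
      D + ∑y * (x * F)              ≈⟨ +-congˡ (trans (*-comm ∑y _) (trans (*-assoc x F ∑y) (x∙yz≈y∙xz x F ∑y))) ⟩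
      D + F * (x * ∑y)              ∎

module PathAdjacency {c ℓ} (R : CommutativeRing c ℓ) where

  open import Data.Nat using (ℕ; zero; suc; _<_; s≤s; ∣_-_∣; _≤ᵇ_; _<ᵇ_)
  open import Data.Fin using (Fin; toℕ)
  open import Data.Bool using (Bool; true; false; if_then_else_) renaming (T to IsTrue)
  import Data.Nat.Properties as ℕₚ
  open import Relation.Binary.PropositionalEquality as ≡ using (_≡_)
  open CommutativeRing R
  open import Algebra.Properties.Semiring.Sum semiring
  open import Relation.Binary.Reasoning.Setoid setoid

  𝟙 : Bool → Carrier
  𝟙 true  = 1#
  𝟙 false = 0#

  *-𝟙 : ∀ x β → x * 𝟙 β ≈ (if β then x else 0#)
  *-𝟙 x true  = *-identityʳ x
  *-𝟙 x false = zeroʳ x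

  private
    before : (ℕ → Carrier) → ℕ → Carrier
    before f zero    = 0#
    before f (suc b) = f b

    neighbour-sum : ∀ k (f : ℕ → Carrier) b → b < k →
      ∑[ a < k ] (if ∣ b - toℕ a ∣ ≤ᵇ 1 then f (toℕ a) else 0#) ≈
      before f b + f b + (if suc b <ᵇ k then f (suc b) else 0#)
    neighbour-sum (suc zero) f zero _ = begin
      f 0 + 0#        ≈⟨ +-identityʳ (f 0) ⟩
      f 0             ≈⟨ +-identityˡ (f 0) ⟨
      0# + f 0        ≈⟨ +-identityʳ (0# + f 0) ⟨
      0# + f 0 + 0#   ∎
    neighbour-sum (suc (suc k)) f zero _ = begin
      f 0 + (f 1 + ∑[ a < k ] 0#)   ≈⟨ +-congˡ (+-congˡ (sum-replicate-zero k)) ⟩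
      f 0 + (f 1 + 0#)              ≈⟨ +-congˡ (+-identityʳ (f 1)) ⟩
      f 0 + f 1                     ≈⟨ +-congʳ (+-identityˡ (f 0)) ⟨
      0# + f 0 + f 1                ∎
    neighbour-sum (suc k) f (suc zero) (s≤s 0<k) = begin
      f 0 + ∑[ a < k ] (if ∣ 0 - toℕ a ∣ ≤ᵇ 1 then f (suc (toℕ a)) else 0#)
        ≈⟨ +-congˡ (neighbour-sum k (λ a → f (suc a)) 0 0<k) ⟩
      f 0 + (0# + f 1 + next)
        ≈⟨ +-congˡ (+-congʳ (+-identityˡ (f 1))) ⟩
      f 0 + (f 1 + next)
        ≈⟨ +-assoc (f 0) (f 1) next ⟨
      f 0 + f 1 + next
        ∎
      where next = if 1 <ᵇ k then f 2 else 0#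
    neighbour-sum (suc k) f (suc (suc b)) (s≤s b+1<k) =
      trans (+-identityˡ _) (neighbour-sum k (λ a → f (suc a)) (suc b) b+1<k)

  -- A column of the adjacency matrix (with loops) of the path 0 — 1 — ⋯ — (k-1) applied to a vector;
  -- padding the vector by zeros at both ends removes the boundary cases.
  adjacency-sum : ∀ k (z : ℕ → Carrier) → z 0 ≈ 0# → z (suc k) ≈ 0# → ∀ b → b < k →
    ∑[ a < k ] (z (suc (toℕ a)) * 𝟙 (∣ b - toℕ a ∣ ≤ᵇ 1)) ≈ z b + z (suc b) + z (suc (suc b))
  adjacency-sum k z z₀≈0 zₖ≈0 b b<k = begin
    ∑[ a < k ] (z (suc (toℕ a)) * 𝟙 (∣ b - toℕ a ∣ ≤ᵇ 1))
      ≈⟨ sum-cong-≋ {k} (λ a → *-𝟙 (z (suc (toℕ a))) _) ⟩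
    ∑[ a < k ] (if ∣ b - toℕ a ∣ ≤ᵇ 1 then z (suc (toℕ a)) else 0#)
      ≈⟨ neighbour-sum k (λ a → z (suc a)) b b<k ⟩
    before (λ a → z (suc a)) b + z (suc b) + (if suc b <ᵇ k then z (suc (suc b)) else 0#)
      ≈⟨ +-cong (+-congʳ (first b)) last ⟩
    z b + z (suc b) + z (suc (suc b))
      ∎
    where
    first : ∀ b → before (λ a → z (suc a)) b ≈ z b
    first zero    = sym z₀≈0
    first (suc b) = refl
    last : (if suc b <ᵇ k then z (suc (suc b)) else 0#) ≈ z (suc (suc b))
    last with suc b <ᵇ k in b+1<ᵇk
    ... | true  = refl
    ... | false = trans (sym zₖ≈0) (reflexive (≡.cong (λ n → z (suc n)) k≡b+1))
      where
      k≡b+1 : k ≡ suc b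
      k≡b+1 = ℕₚ.≤-antisym (ℕₚ.≮⇒≥ λ b+1<k → ≡.subst IsTrue b+1<ᵇk (ℕₚ.<⇒<ᵇ b+1<k)) b<k

module BivariateSeries where

  open import Data.Nat as ℕ using (ℕ; zero; suc; _∸_)
  open import Data.Integer as ℤ using (ℤ; +_)
  import Data.Integer.Properties as ℤₚ
  open import Data.Maybe using (Maybe; just; nothing)
  open import Relation.Nullary using (yes; no)
  open import Relation.Binary.PropositionalEquality as ≡ using (_≡_)
  open import Algebra.Morphism.Structures using (IsRingMonomorphism)
  import Algebra.Morphism.RingMonomorphism as RingMonomorphism
  import Algebra.Solver.Ring.AlmostCommutativeRing as ACR
  import Algebra.Solver.Ring

  module ℤ[[t]] = FormalPowerSeries ℤₚ.+-*-commutativeRing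
  module ℤ[[t]][[x]] = FormalPowerSeries ℤ[[t]].commutativeRing

  sumTo-cong : ∀ n {h h′ : ℕ → ℤ} → (∀ a → h a ≡ h′ a) → sumTo n h ≡ sumTo n h′
  sumTo-cong zero    h≡h′ = h≡h′ 0
  sumTo-cong (suc n) h≡h′ = ≡.cong₂ ℤ._+_ (sumTo-cong n h≡h′) (h≡h′ (suc n))

  sumTo-zero : ∀ n (h : ℕ → ℤ) → (∀ a → h a ≡ + 0) → sumTo n h ≡ + 0
  sumTo-zero zero    h h≡0 = h≡0 0
  sumTo-zero (suc n) h h≡0 = ≡.cong₂ ℤ._+_ (sumTo-zero n h h≡0) (h≡0 (suc n))

  sumTo-head : ∀ n (h : ℕ → ℤ) → sumTo (suc n) h ≡ h 0 ℤ.+ sumTo n (λ a → h (suc a))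
  sumTo-head zero    h = ≡.refl
  sumTo-head (suc n) h = ≡.trans (≡.cong (ℤ._+ h (2 ℕ.+ n)) (sumTo-head n h)) (ℤₚ.+-assoc (h 0) _ _)

  sumTo-first : ∀ n (h : ℕ → ℤ) → (∀ a → h (suc a) ≡ + 0) → sumTo n h ≡ h 0
  sumTo-first zero    h h≡0 = ≡.refl
  sumTo-first (suc n) h h≡0 =
    ≡.trans (≡.cong₂ ℤ._+_ (sumTo-first n h h≡0) (h≡0 n)) (ℤₚ.+-identityʳ (h 0))

  ⊗≡✶ : ∀ f g i j → (f ⊗ g) i j ≡ ℤ[[t]][[x]]._✶_ f g i j
  ⊗≡✶ f g i j = ≡.trans (sumTo-cong i λ a → inner a) (≡.sym (outer i _))
    where
    inner : ∀ a → sumTo j (λ b → f a b ℤ.* g (i ∸ a) (j ∸ b)) ≡ ℤ[[t]]._✶_ (f a) (g (i ∸ a)) j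
    inner a = ≡.sym (Σ≤≡sumTo j)
      where
      Σ≤≡sumTo : ∀ n {h} → ℤ[[t]].Σ≤ n h ≡ sumTo n h
      Σ≤≡sumTo zero        = ≡.refl
      Σ≤≡sumTo (suc n) {h} = ≡.cong (ℤ._+ h (suc n)) (Σ≤≡sumTo n)
    outer : ∀ n H → ℤ[[t]][[x]].Σ≤ n H j ≡ sumTo n (λ a → H a j)
    outer zero    H = ≡.refl
    outer (suc n) H = ≡.cong (ℤ._+ H (suc n) j) (outer n H)

  -- _≈ₛ_ is a Π-type from whose inhabitants Agda cannot recover the two series (as needed for the
  -- implicit arguments of trans, sym and the ring solver); the record keeps them recoverable.
  infix 4 _≋_
  record _≋_ (f g : Ser) : Set where
    constructor mk
    field coefficients : f ≈ₛ g
  open _≋_ public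

  neg : Ser → Ser
  neg f i j = ℤ.- f i j

  rawRing : RawRing 0ℓ 0ℓ
  rawRing = record
    { Carrier = Ser ; _≈_ = _≋_ ; _+_ = _⊕_ ; _*_ = _⊗_ ; -_ = neg
    ; 0# = λ _ _ → + 0 ; 1# = cst (+ 1) }

  cst-1≡𝟏 : ∀ i j → cst (+ 1) i j ≡ ℤ[[t]][[x]].𝟏 i j
  cst-1≡𝟏 zero    zero    = ≡.refl
  cst-1≡𝟏 zero    (suc j) = ≡.refl
  cst-1≡𝟏 (suc i) j       = ≡.refl

  id-isRingMonomorphism : IsRingMonomorphism rawRing (CommutativeRing.rawRing ℤ[[t]][[x]].commutativeRing) (λ f → f)
  id-isRingMonomorphism = record
    { isRingHomomorphism = record
      { isSemiringHomomorphism = record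
        { isNearSemiringHomomorphism = record
          { +-isMonoidHomomorphism = record
            { isMagmaHomomorphism = record
              { isRelHomomorphism = record { cong = coefficients }
              ; homo = λ _ _ _ _ → ≡.refl }
            ; ε-homo = λ _ _ → ≡.refl }
          ; *-homo = ⊗≡✶ }
        ; 1#-homo = cst-1≡𝟏 }
      ; -‿homo = λ _ _ _ → ≡.refl }
    ; injective = mk
    }

  serRing : CommutativeRing 0ℓ 0ℓ
  serRing = record
    { isCommutativeRing =
        RingMonomorphism.isCommutativeRing id-isRingMonomorphism ℤ[[t]][[x]].isCommutativeRing }

  cst-⊗ : ∀ c f i j → (cst c ⊗ f) i j ≡ c ℤ.* f i j
  cst-⊗ c f i j = ≡.trans (sumTo-first i _ λ a → sumTo-zero j _ λ _ → ≡.refl) (sumTo-first j _ λ _ → ≡.refl)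

  X-⊗-zero : ∀ f j → (X ⊗ f) 0 j ≡ + 0
  X-⊗-zero f j = sumTo-zero j _ λ _ → ≡.refl

  X-⊗-suc : ∀ f i j → (X ⊗ f) (suc i) j ≡ f i j
  X-⊗-suc f i j = begin
    (X ⊗ f) (suc i) j
      ≡⟨ sumTo-head i _ ⟩
    sumTo j (λ b → + 0) ℤ.+ sumTo i (λ a → sumTo j (λ b → X (suc a) b ℤ.* f (i ∸ a) (j ∸ b)))
      ≡⟨ ≡.cong₂ ℤ._+_ (sumTo-zero j _ λ _ → ≡.refl) (sumTo-first i _ λ _ → sumTo-zero j _ λ _ → ≡.refl) ⟩
    + 0 ℤ.+ sumTo j (λ b → X 1 b ℤ.* f i (j ∸ b))
      ≡⟨ ℤₚ.+-identityˡ _ ⟩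
    sumTo j (λ b → X 1 b ℤ.* f i (j ∸ b))
      ≡⟨ sumTo-first j _ (λ _ → ≡.refl) ⟩
    + 1 ℤ.* f i j
      ≡⟨ ℤₚ.*-identityˡ _ ⟩
    f i j ∎
    where open ≡.≡-Reasoning

  T-⊗-zero : ∀ f i → (T ⊗ f) i 0 ≡ + 0
  T-⊗-zero f i = sumTo-first i _ λ _ → ≡.refl

  T-⊗-suc : ∀ f i j → (T ⊗ f) i (suc j) ≡ f i j
  T-⊗-suc f i j = begin
    (T ⊗ f) i (suc j)
      ≡⟨ sumTo-first i _ (λ _ → sumTo-zero (suc j) _ λ _ → ≡.refl) ⟩
    sumTo (suc j) (λ b → T 0 b ℤ.* f i (suc j ∸ b))
      ≡⟨ sumTo-head j _ ⟩
    + 0 ℤ.+ sumTo j (λ b → T 0 (suc b) ℤ.* f i (j ∸ b))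
      ≡⟨ ℤₚ.+-identityˡ _ ⟩
    sumTo j (λ b → T 0 (suc b) ℤ.* f i (j ∸ b))
      ≡⟨ sumTo-first j _ (λ _ → ≡.refl) ⟩
    + 1 ℤ.* f i j
      ≡⟨ ℤₚ.*-identityˡ _ ⟩
    f i j ∎
    where open ≡.≡-Reasoning

  cst-0 : cst (+ 0) ≈ₛ λ _ _ → + 0
  cst-0 zero    zero    = ≡.refl
  cst-0 zero    (suc j) = ≡.refl
  cst-0 (suc i) j       = ≡.refl

  cst-homomorphism :
    CommutativeRing.rawRing ℤₚ.+-*-commutativeRing ACR.-Raw-AlmostCommutative⟶ ACR.fromCommutativeRing serRing
  cst-homomorphism = record
    { ⟦_⟧    = cst
    ; +-homo = λ a b → mk (cst-+ a b)
    ; *-homo = λ a b → mk λ i j → ≡.sym (≡.trans (cst-⊗ a (cst b) i j) (cst-* a b i j))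
    ; -‿homo = λ a → mk (cst-neg a)
    ; 0-homo = mk cst-0
    ; 1-homo = mk λ _ _ → ≡.refl
    }
    where
    cst-+ : ∀ a b → cst (a ℤ.+ b) ≈ₛ cst a ⊕ cst b
    cst-+ a b zero    zero    = ≡.refl
    cst-+ a b zero    (suc j) = ≡.refl
    cst-+ a b (suc i) j       = ≡.refl

    cst-* : ∀ a b i j → a ℤ.* cst b i j ≡ cst (a ℤ.* b) i j
    cst-* a b zero    zero    = ≡.refl
    cst-* a b zero    (suc j) = ℤₚ.*-zeroʳ a
    cst-* a b (suc i) j       = ℤₚ.*-zeroʳ a

    cst-neg : ∀ a → cst (ℤ.- a) ≈ₛ neg (cst a)
    cst-neg a zero    zero    = ≡.refl
    cst-neg a zero    (suc j) = ≡.refl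
    cst-neg a (suc i) j       = ≡.refl

  cst-≟ : ∀ a b → Maybe (cst a ≋ cst b)
  cst-≟ a b with a ℤₚ.≟ b
  ... | yes ≡.refl = just (mk λ _ _ → ≡.refl)
  ... | no _       = nothing

  module Solver = Algebra.Solver.Ring (CommutativeRing.rawRing ℤₚ.+-*-commutativeRing)
                                       (ACR.fromCommutativeRing serRing) cst-homomorphism cst-≟

  -- Congruences stated with the operators of Defs. Series are functions, so Agda eta-expands
  -- them during unification and cannot infer an operand from f ⊕ g: fixed operands are explicit.
  open CommutativeRing serRing using (+-cong; *-cong; -‿cong; refl)

  ⊕-cong : ∀ {f f′ g g′} → f ≋ f′ → g ≋ g′ → f ⊕ g ≋ f′ ⊕ g′
  ⊕-cong = +-cong

  ⊕-congˡ : ∀ f {g g′} → g ≋ g′ → f ⊕ g ≋ f ⊕ g′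
  ⊕-congˡ f = ⊕-cong (refl {f})

  ⊕-congʳ : ∀ {f f′} g → f ≋ f′ → f ⊕ g ≋ f′ ⊕ g
  ⊕-congʳ g f≋f′ = ⊕-cong f≋f′ (refl {g})

  ⊗-cong : ∀ {f f′ g g′} → f ≋ f′ → g ≋ g′ → f ⊗ g ≋ f′ ⊗ g′
  ⊗-cong = *-cong

  ⊗-congˡ : ∀ f {g g′} → g ≋ g′ → f ⊗ g ≋ f ⊗ g′
  ⊗-congˡ f = ⊗-cong (refl {f})

  ⊗-congʳ : ∀ {f f′} g → f ≋ f′ → f ⊗ g ≋ f′ ⊗ g
  ⊗-congʳ g f≋f′ = ⊗-cong f≋f′ (refl {g})

  ⊖-cong : ∀ {f f′ g g′} → f ≋ f′ → g ≋ g′ → f ⊖ g ≋ f′ ⊖ g′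
  ⊖-cong f≋f′ g≋g′ = +-cong f≋f′ (-‿cong g≋g′)

  ⊖-congˡ : ∀ f {g g′} → g ≋ g′ → f ⊖ g ≋ f ⊖ g′
  ⊖-congˡ f = ⊖-cong (refl {f})

  ⊖-congʳ : ∀ {f f′} g → f ≋ f′ → f ⊖ g ≋ f′ ⊖ g
  ⊖-congʳ g f≋f′ = ⊖-cong f≋f′ (refl {g})

module WordSeries where

  open import Data.Nat as ℕ using (ℕ; zero; suc; ∣_-_∣; _≤ᵇ_; _≡ᵇ_)
  open import Data.Integer as ℤ using (+_)
  import Data.Integer.Properties as ℤₚ
  import Data.Nat.Properties as ℕₚ
  open import Data.Fin as Fin using (Fin; toℕ)
  open import Data.Vec using (Vec; []; _∷_)
  open import Data.List using (List; []; _∷_; _++_; map; concatMap; allFin; tabulate)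
  import Data.List.Properties as Listₚ
  open import Data.Bool using (Bool; true; false; if_then_else_)
  open import Relation.Binary.PropositionalEquality as ≡ using (_≡_)
  import Relation.Binary.Reasoning.Setoid as SetoidReasoning
  open BivariateSeries
  open Solver using (solve; con; _:+_; _:-_; _:*_; _:=_)
  open CommutativeRing serRing using (setoid; refl; sym; trans)
  open PathAdjacency serRing using (𝟙)
  open import Algebra.Properties.Semiring.Sum (CommutativeRing.semiring serRing)
  import Algebra.Properties.CommutativeMonoid.Sum
  module ℤΣ = Algebra.Properties.CommutativeMonoid.Sum ℤₚ.+-0-commutativeMonoid

  countS-++ : ∀ {k n} j (ws ws′ : List (Vec (Fin k) n)) → countS j (ws ++ ws′) ≡ countS j ws ℕ.+ countS j ws′
  countS-++ j []       ws′ = ≡.refl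
  countS-++ j (w ∷ ws) ws′ = ≡.trans (≡.cong (_ ℕ.+_) (countS-++ j ws ws′)) (≡.sym (ℕₚ.+-assoc (if s w ≡ᵇ j then 1 else 0) _ _))

  countS-concatMap : ∀ {k n m} {B : Set} j (h : B → List (Vec (Fin k) n)) (g : Fin m → B) →
                     + countS j (concatMap h (tabulate g)) ≡ ℤΣ.sum (λ a → + countS j (h (g a)))
  countS-concatMap {m = zero}  j h g = ≡.refl
  countS-concatMap {m = suc m} j h g = begin
    + countS j (h (g Fin.zero) ++ concatMap h (tabulate (λ a → g (Fin.suc a))))
      ≡⟨ ≡.cong +_ (countS-++ j (h (g Fin.zero)) _) ⟩
    + countS j (h (g Fin.zero)) ℤ.+ + countS j (concatMap h (tabulate (λ a → g (Fin.suc a))))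
      ≡⟨ ≡.cong (λ z → + countS j (h (g Fin.zero)) ℤ.+ z) (countS-concatMap j h (λ a → g (Fin.suc a))) ⟩
    + countS j (h (g Fin.zero)) ℤ.+ ℤΣ.sum (λ a → + countS j (h (g (Fin.suc a))))
      ∎
    where open ≡.≡-Reasoning

  ∑-coefficient : ∀ {m} (f : Fin m → Ser) i j → (∑[ a < m ] f a) i j ≡ ℤΣ.sum (λ a → f a i j)
  ∑-coefficient {zero}  f i j = ≡.refl
  ∑-coefficient {suc m} f i j = ≡.cong (λ z → f Fin.zero i j ℤ.+ z) (∑-coefficient (λ a → f (Fin.suc a)) i j)

  module _ (k : ℕ) where

    startingWith : Fin k → Ser
    startingWith a zero    j = + 0
    startingWith a (suc n) j = + countS j (map (a ∷_) (words k n))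

    F-first-letter : F k ≋ cst (+ 1) ⊕ ∑[ a < k ] startingWith a
    F-first-letter = mk coefficient
      where
      open ≡.≡-Reasoning
      no-empty-word : ∀ j → (∑[ a < k ] startingWith a) 0 j ≡ + 0
      no-empty-word j = ≡.trans (∑-coefficient startingWith 0 j) (ℤΣ.sum-replicate-zero k)
      coefficient : F k ≈ₛ cst (+ 1) ⊕ ∑[ a < k ] startingWith a
      coefficient zero    zero    = ≡.cong (λ z → + 1 ℤ.+ z) (≡.sym (no-empty-word 0))
      coefficient zero    (suc j) = ≡.cong (λ z → + 0 ℤ.+ z) (≡.sym (no-empty-word (suc j)))
      coefficient (suc n) j       = begin
        + countS j (concatMap (λ a → map (a ∷_) (words k n)) (allFin k))
          ≡⟨ countS-concatMap j (λ a → map (a ∷_) (words k n)) (λ a → a) ⟩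
        ℤΣ.sum (λ a → startingWith a (suc n) j)
          ≡⟨ ∑-coefficient startingWith (suc n) j ⟨
        (∑[ a < k ] startingWith a) (suc n) j
          ≡⟨ ℤₚ.+-identityˡ _ ⟨
        + 0 ℤ.+ (∑[ a < k ] startingWith a) (suc n) j
          ∎

    adjacent : Fin k → Fin k → Bool
    adjacent a b = ∣ toℕ b - toℕ a ∣ ≤ᵇ 1

    tPower : Bool → Ser
    tPower true  = T
    tPower false = cst (+ 1)

    module _ {n : ℕ} (a b : Fin k) where

      countS-adjacent-zero : adjacent a b ≡ true → ∀ (ws : List (Vec (Fin k) n)) →
                             countS 0 (map (a ∷_) (map (b ∷_) ws)) ≡ 0
      countS-adjacent-zero adj []       = ≡.refl
      countS-adjacent-zero adj (w ∷ ws) rewrite adj = countS-adjacent-zero adj ws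

      countS-adjacent-suc : adjacent a b ≡ true → ∀ j (ws : List (Vec (Fin k) n)) →
                            countS (suc j) (map (a ∷_) (map (b ∷_) ws)) ≡ countS j (map (b ∷_) ws)
      countS-adjacent-suc adj j []       = ≡.refl
      countS-adjacent-suc adj j (w ∷ ws) rewrite adj = ≡.cong (_ ℕ.+_) (countS-adjacent-suc adj j ws)

      countS-nonadjacent : adjacent a b ≡ false → ∀ j (ws : List (Vec (Fin k) n)) →
                           countS j (map (a ∷_) (map (b ∷_) ws)) ≡ countS j (map (b ∷_) ws)
      countS-nonadjacent nadj j []       = ≡.refl
      countS-nonadjacent nadj j (w ∷ ws) rewrite nadj = ≡.cong (_ ℕ.+_) (countS-nonadjacent nadj j ws)

    prepend-letter : ∀ a b n j →
      (tPower (adjacent a b) ⊗ startingWith b) (suc n) j ≡ + countS j (map (a ∷_) (map (b ∷_) (words k n)))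
    prepend-letter a b n j with adjacent a b in adj
    prepend-letter a b n zero    | true  =
      ≡.trans (T-⊗-zero (startingWith b) (suc n)) (≡.cong +_ (≡.sym (countS-adjacent-zero a b adj (words k n))))
    prepend-letter a b n (suc j) | true  =
      ≡.trans (T-⊗-suc (startingWith b) (suc n) j) (≡.cong +_ (≡.sym (countS-adjacent-suc a b adj j (words k n))))
    prepend-letter a b n j       | false =
      ≡.trans (cst-⊗ (+ 1) (startingWith b) (suc n) j)
              (≡.trans (ℤₚ.*-identityˡ _) (≡.cong +_ (≡.sym (countS-nonadjacent a b adj j (words k n)))))

    startingWith-rec : ∀ a → startingWith a ≋ X ⊗ (cst (+ 1) ⊕ ∑[ b < k ] (tPower (adjacent a b) ⊗ startingWith b))
    startingWith-rec a = mk coefficient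
      where
      open ≡.≡-Reasoning
      tails : Fin k → Ser
      tails b = tPower (adjacent a b) ⊗ startingWith b
      R : Ser
      R = cst (+ 1) ⊕ ∑[ b < k ] tails b
      no-empty-tail : ∀ j → (∑[ b < k ] tails b) 0 j ≡ + 0
      no-empty-tail j = ≡.trans (∑-coefficient tails 0 j)
                                (≡.trans (ℤΣ.sum-cong-≋ {k} λ b → vanishes (adjacent a b) {b} j) (ℤΣ.sum-replicate-zero k))
        where
        vanishes : ∀ β {b} j → (tPower β ⊗ startingWith b) 0 j ≡ + 0
        vanishes true  {b} zero    = T-⊗-zero (startingWith b) 0
        vanishes true  {b} (suc j) = T-⊗-suc (startingWith b) 0 j
        vanishes false {b} j       = cst-⊗ (+ 1) (startingWith b) 0 j
      shifted : ∀ n j → startingWith a (suc n) j ≡ R n j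
      shifted zero    zero    = ≡.cong (λ z → + 1 ℤ.+ z) (≡.sym (no-empty-tail 0))
      shifted zero    (suc j) = ≡.cong (λ z → + 0 ℤ.+ z) (≡.sym (no-empty-tail (suc j)))
      shifted (suc n) j       = begin
        + countS j (map (a ∷_) (concatMap (λ b → map (b ∷_) (words k n)) (allFin k)))
          ≡⟨ ≡.cong (λ ws → + countS j ws) (Listₚ.map-concatMap (a ∷_) (λ b → map (b ∷_) (words k n)) (allFin k)) ⟩
        + countS j (concatMap (λ b → map (a ∷_) (map (b ∷_) (words k n))) (allFin k))
          ≡⟨ countS-concatMap j (λ b → map (a ∷_) (map (b ∷_) (words k n))) (λ b → b) ⟩
        ℤΣ.sum (λ b → + countS j (map (a ∷_) (map (b ∷_) (words k n))))
          ≡⟨ ℤΣ.sum-cong-≋ {k} (λ b → prepend-letter a b n j) ⟨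
        ℤΣ.sum (λ b → (tPower (adjacent a b) ⊗ startingWith b) (suc n) j)
          ≡⟨ ∑-coefficient tails (suc n) j ⟨
        (∑[ b < k ] tails b) (suc n) j
          ≡⟨ ℤₚ.+-identityˡ _ ⟨
        R (suc n) j
          ∎
      coefficient : startingWith a ≈ₛ X ⊗ R
      coefficient zero    j = ≡.sym (X-⊗-zero R j)
      coefficient (suc n) j = ≡.trans (shifted n j) (≡.sym (X-⊗-suc R n j))

    startingWith-transfer : ∀ a →
      startingWith a ≋ X ⊗ F k ⊕ u ⊗ ∑[ b < k ] (𝟙 (adjacent a b) ⊗ startingWith b)
    startingWith-transfer a = begin
      startingWith a
        ≈⟨ startingWith-rec a ⟩
      X ⊗ (cst (+ 1) ⊕ ∑[ b < k ] (tPower (adjacent a b) ⊗ startingWith b))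
        ≈⟨ ⊗-congˡ X (⊕-congˡ (cst (+ 1)) (sum-cong-≋ {k} λ b → tPower-split (adjacent a b) (startingWith b))) ⟩
      X ⊗ (cst (+ 1) ⊕ ∑[ b < k ] (startingWith b ⊕ (T ⊖ cst (+ 1)) ⊗ (𝟙 (adjacent a b) ⊗ startingWith b)))
        ≈⟨ ⊗-congˡ X (⊕-congˡ (cst (+ 1)) (trans (∑-distrib-+ {k} startingWith λ b → (T ⊖ cst (+ 1)) ⊗ N b)
                                                 (⊕-congˡ ∑G (sym (*-distribˡ-sum {k} (T ⊖ cst (+ 1)) N))))) ⟩
      X ⊗ (cst (+ 1) ⊕ (∑G ⊕ (T ⊖ cst (+ 1)) ⊗ ∑[ b < k ] N b))
        ≈⟨ solve 4 (λ X T G N → X :* (con (+ 1) :+ (G :+ (T :- con (+ 1)) :* N))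
                                := X :* (con (+ 1) :+ G) :+ X :* (T :- con (+ 1)) :* N) refl X T ∑G (∑[ b < k ] N b) ⟩
      X ⊗ (cst (+ 1) ⊕ ∑G) ⊕ u ⊗ ∑[ b < k ] N b
        ≈⟨ ⊕-congʳ (u ⊗ ∑[ b < k ] N b) (⊗-congˡ X (sym F-first-letter)) ⟩
      X ⊗ F k ⊕ u ⊗ ∑[ b < k ] N b
        ∎
      where
      open SetoidReasoning setoid
      ∑G : Ser
      ∑G = ∑[ b < k ] startingWith b
      N : Fin k → Ser
      N b = 𝟙 (adjacent a b) ⊗ startingWith b
      tPower-split : ∀ β g → tPower β ⊗ g ≋ g ⊕ (T ⊖ cst (+ 1)) ⊗ (𝟙 β ⊗ g)
      tPower-split true  g = solve 2 (λ T g → T :* g := g :+ (T :- con (+ 1)) :* (con (+ 1) :* g)) refl T g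
      tPower-split false g = trans (solve 2 (λ T g → con (+ 1) :* g := g :+ (T :- con (+ 1)) :* (con (+ 0) :* g)) refl T g)
                                   (⊕-congˡ g (⊗-congˡ (T ⊖ cst (+ 1)) (⊗-congʳ g (mk cst-0))))

module ChebyshevVector where

  open import Data.Nat as ℕ using (ℕ; zero; suc; _∸_; _<_; s≤s; ∣_-_∣; _≤ᵇ_)
  import Data.Nat.Properties as ℕₚ
  open import Data.Integer using (+_)
  open import Data.Fin using (Fin; toℕ; fromℕ; inject₁)
  import Data.Fin.Properties as Finₚ
  open import Relation.Binary.PropositionalEquality as ≡ using (_≡_)
  open BivariateSeries
  open Solver using (solve; con; _:+_; _:-_; _:*_; _:=_)
  open CommutativeRing serRing
    using (setoid; refl; sym; trans; reflexive; 0#; *-assoc; *-identityˡ; *-identityʳ; distribˡ; +-comm; zeroˡ)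
  open import Algebra.Properties.Semiring.Sum (CommutativeRing.semiring serRing)
  open PathAdjacency serRing using (𝟙; adjacency-sum)
  open import Relation.Binary.Reasoning.Setoid setoid

  -- W n = b^(n-1) U_(n-1)(φ): the shifted index makes the recurrence hold from n = 0 on.
  W : ℕ → Ser
  W zero    = cst (+ 0)
  W (suc n) = Uh n

  W-rec : ∀ n → W (suc (suc n)) ≋ cst (+ 2) ⊗ aφ ⊗ W (suc n) ⊖ (bφ ^ₛ 2) ⊗ W n
  W-rec zero    = solve 2 (λ a b → con (+ 2) :* a := con (+ 2) :* a :* con (+ 1) :- b :* (b :* con (+ 1)) :* con (+ 0))
                          refl aφ bφ
  W-rec (suc n) = refl

  -- For K = W (1 + k) and a + c = k + 1, Y a c = v b^k (U_k - U_(a-1) - U_(c-1)).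
  module Antidiagonal (K : Ser) where

    Ŷ : Ser → Ser → Ser → Ser → Ser
    Ŷ p w q w′ = v ⊗ (K ⊖ p ⊗ w ⊖ q ⊗ w′)

    Y : ℕ → ℕ → Ser
    Y a c = Ŷ (bφ ^ₛ c) (W a) (bφ ^ₛ a) (W c)

    Ŷ-cong : ∀ p q {w w₁ w′ w′₁} → w ≋ w₁ → w′ ≋ w′₁ → Ŷ p w q w′ ≋ Ŷ p w₁ q w′₁
    Ŷ-cong p q w≋w₁ w′≋w′₁ = ⊗-congˡ v (⊖-cong (⊖-congˡ K (⊗-congˡ p w≋w₁)) (⊗-congˡ q w′≋w′₁))

    three-term : ∀ a c →
      Y (suc a) (suc c) ≋ (v ^ₛ 2) ⊗ K ⊕ u ⊗ (Y a (suc (suc c)) ⊕ Y (suc a) (suc c) ⊕ Y (suc (suc a)) c)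
    three-term a c = trans
      (identity u K (W a) (W (suc a)) (W c) (W (suc c)) (bφ ^ₛ a) (bφ ^ₛ c))
      (sym (⊕-congˡ ((v ^ₛ 2) ⊗ K) (⊗-congˡ u (⊕-cong
        (⊕-congʳ (Y (suc a) (suc c)) (Ŷ-cong (bφ ^ₛ suc (suc c)) (bφ ^ₛ a) (refl {W a}) (W-rec c)))
        (Ŷ-cong (bφ ^ₛ c) (bφ ^ₛ suc (suc a)) (W-rec a) (refl {W c}))))))
      where
      identity = solve 8 (λ u K Wa Wa′ Wc Wc′ pa pc →
        let b  = con (+ 2) :* u
            v  = con (+ 1) :- con (+ 3) :* u
            Wrec : _ → _ → _
            Wrec W′ W = con (+ 2) :* (con (+ 1) :- u) :* W′ :- b :* (b :* con (+ 1)) :* W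
            Y₁ = v :* (K :- b :* (b :* pc) :* Wa :- pa :* Wrec Wc′ Wc)
            Y₂ = v :* (K :- b :* pc :* Wa′ :- b :* pa :* Wc′)
            Y₃ = v :* (K :- pc :* Wrec Wa′ Wa :- b :* (b :* pa) :* Wc)
        in Y₂ := v :* (v :* con (+ 1)) :* K :+ u :* (Y₁ :+ Y₂ :+ Y₃)) refl

  open Antidiagonal using (Y; three-term)
  open import Algebra.Solver.Ring.AlmostCommutativeRing using (_-Raw-AlmostCommutative⟶_)

  Y-left-edge : ∀ c → Y (W c) 0 c ≋ 0#
  Y-left-edge c = trans
    (solve 3 (λ u p w → (con (+ 1) :- con (+ 3) :* u) :* (w :- p :* con (+ 0) :- con (+ 1) :* w) := con (+ 0))
           refl u (bφ ^ₛ c) (W c))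
    (mk cst-0)

  Y-right-edge : ∀ a → Y (W a) a 0 ≋ 0#
  Y-right-edge a = trans
    (solve 3 (λ u p w → (con (+ 1) :- con (+ 3) :* u) :* (w :- con (+ 1) :* w :- p :* con (+ 0)) := con (+ 0))
           refl u (bφ ^ₛ a) (W a))
    (mk cst-0)

  -- Homogenised form of (φ - 1) Σ_{i<n} U_i(φ) = (U_n(φ) - U_{n-1}(φ) - 1)/2, where Z n = b^n Σ_{i<n} U_i(φ);
  -- note v = b(φ - 1) and u = b/2.
  chebyshev-partial-sum : (Z : ℕ → Ser) → Z 0 ≋ 0# → (∀ n → Z (suc n) ≋ bφ ⊗ (Z n ⊕ W (suc n))) →
                          ∀ n → v ⊗ Z n ≋ u ⊗ (W (suc n) ⊖ bφ ⊗ W n ⊖ bφ ^ₛ n)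
  chebyshev-partial-sum Z Z₀≋0 Z-rec zero = trans
    (⊗-congˡ v (trans Z₀≋0 (sym (mk cst-0))))
    (solve 1 (λ u → (con (+ 1) :- con (+ 3) :* u) :* con (+ 0)
                    := u :* (con (+ 1) :- con (+ 2) :* u :* con (+ 0) :- con (+ 1))) refl u)
  chebyshev-partial-sum Z Z₀≋0 Z-rec (suc n) = begin
    v ⊗ Z (suc n)
      ≈⟨ ⊗-congˡ v (Z-rec n) ⟩
    v ⊗ (bφ ⊗ (Z n ⊕ W (suc n)))
      ≈⟨ solve 3 (λ u Z W → let b = con (+ 2) :* u; v = con (+ 1) :- con (+ 3) :* u in
                   v :* (b :* (Z :+ W)) := b :* (v :* Z) :+ b :* v :* W) refl u (Z n) (W (suc n)) ⟩
    bφ ⊗ (v ⊗ Z n) ⊕ bφ ⊗ v ⊗ W (suc n)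
      ≈⟨ ⊕-congʳ (bφ ⊗ v ⊗ W (suc n)) (⊗-congˡ bφ (chebyshev-partial-sum Z Z₀≋0 Z-rec n)) ⟩
    bφ ⊗ (u ⊗ (W (suc n) ⊖ bφ ⊗ W n ⊖ bφ ^ₛ n)) ⊕ bφ ⊗ v ⊗ W (suc n)
      ≈⟨ solve 4 (λ u W′ W p → let b = con (+ 2) :* u; v = con (+ 1) :- con (+ 3) :* u in
                   b :* (u :* (W′ :- b :* W :- p)) :+ b :* v :* W′
                   := u :* (con (+ 2) :* (con (+ 1) :- u) :* W′ :- b :* (b :* con (+ 1)) :* W :- b :* W′ :- b :* p))
                 refl u (W (suc n)) (W n) (bφ ^ₛ n) ⟩
    u ⊗ (cst (+ 2) ⊗ aφ ⊗ W (suc n) ⊖ (bφ ^ₛ 2) ⊗ W n ⊖ bφ ⊗ W (suc n) ⊖ bφ ^ₛ suc n)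
      ≈⟨ ⊗-congˡ u (⊖-congʳ (bφ ^ₛ suc n) (⊖-congʳ (bφ ⊗ W (suc n)) (W-rec n))) ⟨
    u ⊗ (W (suc (suc n)) ⊖ bφ ⊗ W (suc n) ⊖ bφ ^ₛ suc n)
      ∎

  P-term Q-term : ℕ → ℕ → Ser
  P-term n i = (bφ ^ₛ (n ∸ i)) ⊗ W (suc i)
  Q-term n i = (bφ ^ₛ suc i) ⊗ W (n ∸ i)

  P Q : ℕ → Ser
  P n = ∑[ i < n ] P-term n (toℕ i)
  Q n = ∑[ i < n ] Q-term n (toℕ i)

  P-rec : ∀ n → P (suc n) ≋ bφ ⊗ (P n ⊕ W (suc n))
  P-rec n = begin
    P (suc n)
      ≈⟨ sum-init-last {n} (λ i → P-term (suc n) (toℕ i)) ⟩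
    ∑[ i < n ] P-term (suc n) (toℕ (inject₁ i)) ⊕ P-term (suc n) (toℕ (fromℕ n))
      ≈⟨ ⊕-cong (sum-cong-≋ {n} λ i → reflexive (≡.cong (P-term (suc n)) (Finₚ.toℕ-inject₁ i)))
                (reflexive (≡.cong (P-term (suc n)) (Finₚ.toℕ-fromℕ n))) ⟩
    ∑[ i < n ] P-term (suc n) (toℕ i) ⊕ P-term (suc n) n
      ≈⟨ ⊕-cong (sum-cong-≋ {n} λ i → P-term-suc (toℕ i) (ℕₚ.<⇒≤ (Finₚ.toℕ<n i))) (P-term-suc n ℕₚ.≤-refl) ⟩
    ∑[ i < n ] (bφ ⊗ P-term n (toℕ i)) ⊕ bφ ⊗ P-term n n
      ≈⟨ ⊕-congˡ (∑[ i < n ] (bφ ⊗ P-term n (toℕ i))) (⊗-congˡ bφ P-term-diagonal) ⟩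
    ∑[ i < n ] (bφ ⊗ P-term n (toℕ i)) ⊕ bφ ⊗ W (suc n)
      ≈⟨ ⊕-congʳ (bφ ⊗ W (suc n)) (*-distribˡ-sum {n} bφ λ i → P-term n (toℕ i)) ⟨
    bφ ⊗ P n ⊕ bφ ⊗ W (suc n)
      ≈⟨ distribˡ bφ (P n) (W (suc n)) ⟨
    bφ ⊗ (P n ⊕ W (suc n))
      ∎
    where
    P-term-suc : ∀ i → i ℕ.≤ n → P-term (suc n) i ≋ bφ ⊗ P-term n i
    P-term-suc i i≤n = trans (reflexive (≡.cong (λ e → (bφ ^ₛ e) ⊗ W (suc i)) (ℕₚ.+-∸-assoc 1 i≤n)))
                             (*-assoc bφ (bφ ^ₛ (n ∸ i)) (W (suc i)))
    P-term-diagonal : P-term n n ≋ W (suc n)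
    P-term-diagonal = trans (reflexive (≡.cong (λ e → (bφ ^ₛ e) ⊗ W (suc n)) (ℕₚ.n∸n≡0 n)))
                            (*-identityˡ (W (suc n)))

  Q-rec : ∀ n → Q (suc n) ≋ bφ ⊗ (Q n ⊕ W (suc n))
  Q-rec n = begin
    (bφ ⊗ cst (+ 1)) ⊗ W (suc n) ⊕ ∑[ i < n ] ((bφ ⊗ (bφ ^ₛ suc (toℕ i))) ⊗ W (n ∸ toℕ i))
      ≈⟨ ⊕-cong (⊗-congʳ (W (suc n)) (*-identityʳ bφ))
                (sum-cong-≋ {n} λ i → *-assoc bφ (bφ ^ₛ suc (toℕ i)) (W (n ∸ toℕ i))) ⟩
    bφ ⊗ W (suc n) ⊕ ∑[ i < n ] (bφ ⊗ Q-term n (toℕ i))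
      ≈⟨ ⊕-congˡ (bφ ⊗ W (suc n)) (*-distribˡ-sum {n} bφ λ i → Q-term n (toℕ i)) ⟨
    bφ ⊗ W (suc n) ⊕ bφ ⊗ Q n
      ≈⟨ distribˡ bφ (W (suc n)) (Q n) ⟨
    bφ ⊗ (W (suc n) ⊕ Q n)
      ≈⟨ ⊗-congˡ bφ (+-comm (W (suc n)) (Q n)) ⟩
    bφ ⊗ (Q n ⊕ W (suc n))
      ∎

  ∑-const : ∀ k c → ∑[ i < k ] c ≋ cst (+ k) ⊗ c
  ∑-const zero    c = sym (trans (⊗-congʳ c (mk cst-0)) (zeroˡ c))
  ∑-const (suc k) c = begin
    c ⊕ ∑[ i < k ] c                 ≈⟨ ⊕-congˡ c (∑-const k c) ⟩
    c ⊕ cst (+ k) ⊗ c                ≈⟨ solve 2 (λ c ck → c :+ ck :* c := (con (+ 1) :+ ck) :* c) refl c (cst (+ k)) ⟩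
    (cst (+ 1) ⊕ cst (+ k)) ⊗ c      ≈⟨ ⊗-congʳ c (+-homo (+ 1) (+ k)) ⟨
    cst (+ suc k) ⊗ c                ∎
    where open _-Raw-AlmostCommutative⟶_ cst-homomorphism using (+-homo)

  -- Shifted by one: padded k (1 + a) = y_a, and padded k 0 and padded k (1 + k) vanish.
  padded : ℕ → ℕ → Ser
  padded k j = Y (Uh k) j (suc k ∸ j)

  chebyshevVector : (k : ℕ) → Fin k → Ser
  chebyshevVector k a = padded k (suc (toℕ a))

  chebyshevVector-rec : ∀ k (b : Fin k) →
    chebyshevVector k b ≋ Dk k ⊕ u ⊗ ∑[ a < k ] (chebyshevVector k a ⊗ 𝟙 (∣ toℕ b - toℕ a ∣ ≤ᵇ 1))
  chebyshevVector-rec k b = begin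
    Y K (suc i) (k ∸ i)
      ≈⟨ reflexive (≡.cong (Y K (suc i)) k∸i≡1+c) ⟩
    Y K (suc i) (suc c)
      ≈⟨ three-term K i c ⟩
    Dk k ⊕ u ⊗ (Y K i (suc (suc c)) ⊕ Y K (suc i) (suc c) ⊕ Y K (suc (suc i)) c)
      ≈⟨ reflexive (≡.cong₂ (λ s t → Dk k ⊕ u ⊗ (Y K i s ⊕ Y K (suc i) t ⊕ Y K (suc (suc i)) c))
                            1+k∸i≡2+c k∸i≡1+c) ⟨
    Dk k ⊕ u ⊗ (padded k i ⊕ padded k (suc i) ⊕ padded k (suc (suc i)))
      ≈⟨ ⊕-congˡ (Dk k) (⊗-congˡ u (adjacency-sum k (padded k) (Y-left-edge (suc k)) right-edge i i<k)) ⟨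
    Dk k ⊕ u ⊗ ∑[ a < k ] (chebyshevVector k a ⊗ 𝟙 (∣ i - toℕ a ∣ ≤ᵇ 1))
      ∎
    where
    K = Uh k
    i = toℕ b
    c = k ∸ suc i
    i<k : i < k
    i<k = Finₚ.toℕ<n b
    k∸i≡1+c : k ∸ i ≡ suc c
    k∸i≡1+c = ∸≡suc∸suc i<k
      where
      ∸≡suc∸suc : ∀ {k i} → i < k → k ∸ i ≡ suc (k ∸ suc i)
      ∸≡suc∸suc {suc k} (s≤s i≤k) = ℕₚ.+-∸-assoc 1 i≤k
    1+k∸i≡2+c : suc k ∸ i ≡ suc (suc c)
    1+k∸i≡2+c = ≡.trans (ℕₚ.+-∸-assoc 1 (ℕₚ.<⇒≤ i<k)) (≡.cong suc k∸i≡1+c)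
    right-edge : padded k (suc k) ≋ 0#
    right-edge = trans (reflexive (≡.cong (Y K (suc k)) (ℕₚ.n∸n≡0 k))) (Y-right-edge (suc k))

  ∑-chebyshevVector : ∀ m → X ⊗ ∑[ a < suc m ] chebyshevVector (suc m) a ≋ xγNum (suc m)
  ∑-chebyshevVector m = begin
    X ⊗ ∑y
      ≈⟨ solve 4 (λ X S A B → X :* S := X :* (S :+ A :+ B :- A :- B)) refl X ∑y (v ⊗ P k) (v ⊗ Q k) ⟩
    X ⊗ (∑y ⊕ v ⊗ P k ⊕ v ⊗ Q k ⊖ v ⊗ P k ⊖ v ⊗ Q k)
      ≈⟨ ⊗-congˡ X (⊖-cong (⊖-cong total (chebyshev-partial-sum P refl P-rec k))
                           (chebyshev-partial-sum Q refl Q-rec k)) ⟩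
    X ⊗ (cst (+ k) ⊗ (v ⊗ K) ⊖ C ⊖ C)
      ≈⟨ solve 6 (λ X ck u K W p →
           let b = con (+ 2) :* u
               v = con (+ 1) :- con (+ 3) :* u
               C = u :* (K :- b :* W :- p)
           in X :* (ck :* (v :* K) :- C :- C) := X :* (ck :* v :* K :- con (+ 2) :* u :* (K :- b :* W :- p)))
         refl X (cst (+ k)) u K (W k) (bφ ^ₛ k) ⟩
    xγNum k
      ∎
    where
    k = suc m
    K = Uh k
    ∑y = ∑[ a < k ] chebyshevVector k a
    C = u ⊗ (W (suc k) ⊖ bφ ⊗ W k ⊖ bφ ^ₛ k)
    p q : Fin k → Ser
    p i = P-term k (toℕ i)
    q i = Q-term k (toℕ i)
    total : ∑y ⊕ v ⊗ P k ⊕ v ⊗ Q k ≋ cst (+ k) ⊗ (v ⊗ K)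
    total = begin
      ∑y ⊕ v ⊗ P k ⊕ v ⊗ Q k
        ≈⟨ ⊕-cong (⊕-congˡ ∑y (*-distribˡ-sum {k} v p)) (*-distribˡ-sum {k} v q) ⟩
      ∑y ⊕ ∑[ i < k ] (v ⊗ p i) ⊕ ∑[ i < k ] (v ⊗ q i)
        ≈⟨ trans (∑-distrib-+ {k} (λ i → chebyshevVector k i ⊕ v ⊗ p i) λ i → v ⊗ q i)
                 (⊕-congʳ (∑[ i < k ] (v ⊗ q i)) (∑-distrib-+ {k} (chebyshevVector k) λ i → v ⊗ p i)) ⟨
      ∑[ i < k ] (chebyshevVector k i ⊕ v ⊗ p i ⊕ v ⊗ q i)
        ≈⟨ sum-cong-≋ {k} (λ i → solve 4 (λ u K p q → let v = con (+ 1) :- con (+ 3) :* u in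
                                   v :* (K :- p :- q) :+ v :* p :+ v :* q := v :* K) refl u K (p i) (q i)) ⟩
      ∑[ i < k ] (v ⊗ K)
        ≈⟨ ∑-const k (v ⊗ K) ⟩
      cst (+ k) ⊗ (v ⊗ K)
        ∎

open import Data.Nat using (suc)
open BivariateSeries
open WordSeries
open ChebyshevVector
open PathAdjacency serRing using (𝟙)
open TransferMatrix serRing using (transfer-matrix-solution)
open CommutativeRing serRing using (trans; sym)

theorem1 : (k : ℕ) → 2 ≤ k → F k ⊗ (Dk k ⊖ xγNum k) ≈ₛ Dk k
theorem1 k@(suc m) _ = coefficients (trans
  (⊗-congˡ (F k) (⊖-congˡ (Dk k) (sym (∑-chebyshevVector m))))
  (transfer-matrix-solution (λ a b → 𝟙 (adjacent k a b)) (startingWith k) (chebyshevVector k) (F k) X u (Dk k)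
                            (F-first-letter k) (startingWith-transfer k) (chebyshevVector-rec k)))
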